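{- Let $a,b$ be distinct integers with $a\equiv b\pmod 5$ and $5\nmid ab$. Let $m,n$ be integers and let $(x,y,z,t)$ be integers with $m=x^{2}+y^{2}+z^{2}+t^{2}$ and $n=ax+ay+az+bt$. Suppose at least one of the following holds: $x-2y+2z-t\equiv0\pmod 5$; $x+2y-2z-t\equiv0\pmod 5$; $x-y-2z+2t\equiv0\pmod 5$; $x-y+2z-2t\equiv0\pmod 5$; $x+2y-z-2t\equiv0\pmod 5$; $x-2y-z+2t\equiv0\pmod 5$. Then there exist integers $x',y',z',t'$ with $m=x'^{2}+y'^{2}+z'^{2}+t'^{2}$ and $$n=\frac{a+4b}{5}x'+\frac{7a-2b}{5}y'+\frac{3a+2b}{5}z'+\frac{4a+b}{5}t'.$$
   Context: Under the hypotheses $a\equiv b\pmod 5$, the four coefficients $\frac{a+4b}{5},\frac{7a-2b}{5},\frac{3a+2b}{5},\frac{4a+b}{5}$ are integers. -}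

module Defs where

open import Data.Integer using (ℤ; _-_; _+_; _*_; -_)
open import Data.Integer.Divisibility using (_∣_)
open import Relation.Nullary using (¬_)

_≡_[mod_] : ℤ → ℤ → ℤ → Set
u ≡ v [mod k ] = k ∣ (u - v)

infix 4 _≡_[mod_]

-- Write a = b + 5k. Then the four new coefficients are b + k, b + 7k, b + 3k, b + 4k, and for
-- v = (1, -2, 2, -1) and w = (x, y, z, t) with w · v = 5q, the vector (t + q, y + 2q, z - 2q, x - q)
-- is the reflection w - q v of w in the hyperplane v⊥ (|v|² = 10) with first and last coordinates
-- swapped. It has the same sum of squares as w, and its value under the new form is
-- (b + 5k)(x + y + z) + b t. The six congruence conditions are the condition w · v ≡ 0 (mod 5)
-- applied to the six permutations of (x, y, z), up to multiplication by a unit mod 5, and both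
-- m and n are symmetric in x, y, z.
module Submission where

open import Defs
open import Data.Integer using (ℤ; _+_; _-_; _*_; +_; _/_; -[1+_]; _/ℕ_; -_)
open import Data.Integer.Divisibility using (_∣_)
open import Data.Integer.Divisibility.Signed using (∣ᵤ⇒∣; ∣⇒∣ᵤ; divides; ∣-refl; ∣n⇒∣m*n; ∣m∣n⇒∣m+n)
  renaming (_∣_ to _∣ˢ_)
open import Data.Integer.DivMod using (div-pos-is-/ℕ)
open import Data.Integer.Properties using (+-identityʳ; pos-*)
open import Data.Integer.Tactic.RingSolver using (solve-∀)
import Data.Nat as ℕ
import Data.Nat.DivMod as ℕ
open import Data.Product using (∃; ∃-syntax; _×_; _,_)
open import Data.Sum using (_⊎_; inj₁; inj₂)
open import Function using (_∘_)
open import Relation.Binary.PropositionalEquality using (_≡_; _≢_; refl; sym; trans; cong; subst; subst₂)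
open import Relation.Nullary using (¬_)

*-/ℕ-cancelʳ : ∀ w d .{{_ : ℕ.NonZero d}} → (w * + d) /ℕ d ≡ w
*-/ℕ-cancelʳ (+ n) d = trans (cong (_/ℕ d) (sym (pos-* n d))) (cong +_ (ℕ.m*n/n≡m n d))
*-/ℕ-cancelʳ -[1+ n ] d@(ℕ.suc _) = exact (ℕ.m*n%n≡0 (ℕ.suc n) d)
  where
  -- _/ℕ_ on a negative dividend branches on the remainder, which vanishes here.
  exact : ℕ.suc n ℕ.* d ℕ.% d ≡ 0 → (-[1+ n ] * + d) /ℕ d ≡ -[1+ n ]
  exact p with ℕ.suc n ℕ.* d ℕ.% d
  exact refl | 0 = cong (-_ ∘ +_) (ℕ.m*n/n≡m (ℕ.suc n) d)

/-exact : ∀ {u} w d .{{_ : ℕ.NonZero d}} → u ≡ w * + d → u / + d ≡ w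
/-exact w d refl = trans (div-pos-is-/ℕ (w * + d) d) (*-/ℕ-cancelʳ w d)

≡0-mod-combination : ∀ {d v} u c w → u ≡ + 0 [mod d ] → v ≡ c * u + w * d → v ≡ + 0 [mod d ]
≡0-mod-combination {d} {v} u c w d∣u v≡ =
  ∣⇒∣ᵤ (subst (d ∣ˢ_) v-+0≡ (∣m∣n⇒∣m+n (∣n⇒∣m*n c d∣ˢu) (∣n⇒∣m*n w ∣-refl)))
  where
  d∣ˢu : d ∣ˢ u
  d∣ˢu = subst (d ∣ˢ_) (+-identityʳ u) (∣ᵤ⇒∣ {i = u - + 0} d∣u)
  v-+0≡ : c * u + w * d ≡ v - + 0
  v-+0≡ = trans (sym v≡) (sym (+-identityʳ v))

≡-mod⇒≡+multiple : ∀ {a b d} → a ≡ b [mod d ] → ∃ λ k → a ≡ b + k * d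
≡-mod⇒≡+multiple {a} {b} a≡b with divides k a-b≡ ← ∣ᵤ⇒∣ {i = a - b} a≡b =
  k , trans (a≡b+[a-b] a b) (cong (λ r → b + r) a-b≡)
  where
  a≡b+[a-b] : ∀ a b → a ≡ b + (a - b)
  a≡b+[a-b] = solve-∀

Represents : (c₁ c₂ c₃ c₄ m n : ℤ) → Set
Represents c₁ c₂ c₃ c₄ m n = ∃[ x ] ∃[ y ] ∃[ z ] ∃[ t ]
  (m ≡ x * x + y * y + z * z + t * t × n ≡ c₁ * x + c₂ * y + c₃ * z + c₄ * t)

Represented : (b k x y z t : ℤ) → Set
Represented b k x y z t = Represents (b + k) (b + + 7 * k) (b + + 3 * k) (b + + 4 * k)
  (x * x + y * y + z * z + t * t) ((b + k * + 5) * x + (b + k * + 5) * y + (b + k * + 5) * z + b * t)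

Represented-reflection : ∀ b k q y z t → Represented b k (q * + 5 + (+ 2 * y - + 2 * z + t)) y z t
Represented-reflection b k q y z t =
  t + q , y + + 2 * q , z - + 2 * q , x - q , sumSq-invariant q y z t , value-invariant b k q y z t
  where
  x : ℤ
  x = q * + 5 + (+ 2 * y - + 2 * z + t)
  sumSq-invariant : ∀ q y z t →
    (q * + 5 + (+ 2 * y - + 2 * z + t)) * (q * + 5 + (+ 2 * y - + 2 * z + t)) + y * y + z * z + t * t
      ≡ (t + q) * (t + q) + (y + + 2 * q) * (y + + 2 * q) + (z - + 2 * q) * (z - + 2 * q)
        + (q * + 5 + (+ 2 * y - + 2 * z + t) - q) * (q * + 5 + (+ 2 * y - + 2 * z + t) - q)
  sumSq-invariant = solve-∀
  value-invariant : ∀ b k q y z t →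
    (b + k * + 5) * (q * + 5 + (+ 2 * y - + 2 * z + t)) + (b + k * + 5) * y + (b + k * + 5) * z + b * t
      ≡ (b + k) * (t + q) + (b + + 7 * k) * (y + + 2 * q) + (b + + 3 * k) * (z - + 2 * q)
        + (b + + 4 * k) * (q * + 5 + (+ 2 * y - + 2 * z + t) - q)
  value-invariant = solve-∀

module _ (b k t : ℤ) where

  Represented-case₁ : ∀ x y z → x - + 2 * y + + 2 * z - t ≡ + 0 [mod + 5 ] → Represented b k x y z t
  Represented-case₁ x y z 5∣ with divides q eq ← ∣ᵤ⇒∣ {i = x - + 2 * y + + 2 * z - t - + 0} 5∣ =
    subst (λ x → Represented b k x y z t) (sym x≡) (Represented-reflection b k q y z t)
    where
    x-decomposition : ∀ x y z t → x ≡ (x - + 2 * y + + 2 * z - t - + 0) + (+ 2 * y - + 2 * z + t)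
    x-decomposition = solve-∀
    x≡ : x ≡ q * + 5 + (+ 2 * y - + 2 * z + t)
    x≡ = trans (x-decomposition x y z t) (cong (_+ (+ 2 * y - + 2 * z + t)) eq)

  Represented-swap₁₂ : ∀ x y z → Represented b k y x z t → Represented b k x y z t
  Represented-swap₁₂ x y z =
    subst₂ (Represents (b + k) (b + + 7 * k) (b + + 3 * k) (b + + 4 * k)) (sumSq-swap x y z t) (value-swap b k x y z t)
    where
    sumSq-swap : ∀ x y z t → y * y + x * x + z * z + t * t ≡ x * x + y * y + z * z + t * t
    sumSq-swap = solve-∀
    value-swap : ∀ b k x y z t →
      (b + k * + 5) * y + (b + k * + 5) * x + (b + k * + 5) * z + b * t
        ≡ (b + k * + 5) * x + (b + k * + 5) * y + (b + k * + 5) * z + b * t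
    value-swap = solve-∀

  Represented-swap₂₃ : ∀ x y z → Represented b k x z y t → Represented b k x y z t
  Represented-swap₂₃ x y z =
    subst₂ (Represents (b + k) (b + + 7 * k) (b + + 3 * k) (b + + 4 * k)) (sumSq-swap x y z t) (value-swap b k x y z t)
    where
    sumSq-swap : ∀ x y z t → x * x + z * z + y * y + t * t ≡ x * x + y * y + z * z + t * t
    sumSq-swap = solve-∀
    value-swap : ∀ b k x y z t →
      (b + k * + 5) * x + (b + k * + 5) * z + (b + k * + 5) * y + b * t
        ≡ (b + k * + 5) * x + (b + k * + 5) * y + (b + k * + 5) * z + b * t
    value-swap = solve-∀

  Represented-any-case : ∀ x y z →
    ( (x - + 2 * y + + 2 * z - t ≡ + 0 [mod + 5 ])
    ⊎ (x + + 2 * y - + 2 * z - t ≡ + 0 [mod + 5 ])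
    ⊎ (x - y - + 2 * z + + 2 * t ≡ + 0 [mod + 5 ])
    ⊎ (x - y + + 2 * z - + 2 * t ≡ + 0 [mod + 5 ])
    ⊎ (x + + 2 * y - z - + 2 * t ≡ + 0 [mod + 5 ])
    ⊎ (x - + 2 * y - z + + 2 * t ≡ + 0 [mod + 5 ]) ) →
    Represented b k x y z t
  Represented-any-case x y z (inj₁ h) = Represented-case₁ x y z h
  Represented-any-case x y z (inj₂ (inj₁ h)) =
    Represented-swap₂₃ x y z (Represented-case₁ x z y
      (subst (_≡ + 0 [mod + 5 ]) (xzy x y z t) h))
    where
    xzy : ∀ x y z t → x + + 2 * y - + 2 * z - t ≡ x - + 2 * z + + 2 * y - t
    xzy = solve-∀
  Represented-any-case x y z (inj₂ (inj₂ (inj₁ h))) =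
    Represented-swap₁₂ x y z (Represented-swap₂₃ y x z (Represented-swap₁₂ y z x (Represented-case₁ z y x
      (≡0-mod-combination (x - y - + 2 * z + + 2 * t) (+ 2) (z - t) h (zyx x y z t)))))
    where
    zyx : ∀ x y z t → z - + 2 * y + + 2 * x - t ≡ + 2 * (x - y - + 2 * z + + 2 * t) + (z - t) * + 5
    zyx = solve-∀
  Represented-any-case x y z (inj₂ (inj₂ (inj₂ (inj₁ h)))) =
    Represented-swap₂₃ x y z (Represented-swap₁₂ x z y (Represented-case₁ z x y
      (≡0-mod-combination (x - y + + 2 * z - + 2 * t) (- + 2) (z - t) h (zxy x y z t))))
    where
    zxy : ∀ x y z t → z - + 2 * x + + 2 * y - t ≡ - + 2 * (x - y + + 2 * z - + 2 * t) + (z - t) * + 5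
    zxy = solve-∀
  Represented-any-case x y z (inj₂ (inj₂ (inj₂ (inj₂ (inj₁ h))))) =
    Represented-swap₁₂ x y z (Represented-case₁ y x z
      (≡0-mod-combination (x + + 2 * y - z - + 2 * t) (- + 2) (y - t) h (yxz x y z t)))
    where
    yxz : ∀ x y z t → y - + 2 * x + + 2 * z - t ≡ - + 2 * (x + + 2 * y - z - + 2 * t) + (y - t) * + 5
    yxz = solve-∀
  Represented-any-case x y z (inj₂ (inj₂ (inj₂ (inj₂ (inj₂ h))))) =
    Represented-swap₁₂ x y z (Represented-swap₂₃ y x z (Represented-case₁ y z x
      (≡0-mod-combination (x - + 2 * y - z + + 2 * t) (+ 2) (y - t) h (yzx x y z t))))
    where
    yzx : ∀ x y z t → y - + 2 * z + + 2 * x - t ≡ + 2 * (x - + 2 * y - z + + 2 * t) + (y - t) * + 5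
    yzx = solve-∀

/5-coefficients : ∀ b k →
    (b + k * + 5 + + 4 * b) / + 5 ≡ b + k
  × (+ 7 * (b + k * + 5) - + 2 * b) / + 5 ≡ b + + 7 * k
  × (+ 3 * (b + k * + 5) + + 2 * b) / + 5 ≡ b + + 3 * k
  × (+ 4 * (b + k * + 5) + b) / + 5 ≡ b + + 4 * k
/5-coefficients b k =
  /-exact (b + k) 5 (c₁ b k) , /-exact (b + + 7 * k) 5 (c₂ b k) ,
  /-exact (b + + 3 * k) 5 (c₃ b k) , /-exact (b + + 4 * k) 5 (c₄ b k)
  where
  c₁ : ∀ b k → b + k * + 5 + + 4 * b ≡ (b + k) * + 5
  c₁ = solve-∀
  c₂ : ∀ b k → + 7 * (b + k * + 5) - + 2 * b ≡ (b + + 7 * k) * + 5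
  c₂ = solve-∀
  c₃ : ∀ b k → + 3 * (b + k * + 5) + + 2 * b ≡ (b + + 3 * k) * + 5
  c₃ = solve-∀
  c₄ : ∀ b k → + 4 * (b + k * + 5) + b ≡ (b + + 4 * k) * + 5
  c₄ = solve-∀

lemma3p7 : (a b : ℤ) → a ≢ b → a ≡ b [mod + 5 ] → ¬ (+ 5 ∣ a * b) →
    (m n x y z t : ℤ) →
    m ≡ x * x + y * y + z * z + t * t →
    n ≡ a * x + a * y + a * z + b * t →
    ( (x - + 2 * y + + 2 * z - t ≡ + 0 [mod + 5 ])
    ⊎ (x + + 2 * y - + 2 * z - t ≡ + 0 [mod + 5 ])
    ⊎ (x - y - + 2 * z + + 2 * t ≡ + 0 [mod + 5 ])
    ⊎ (x - y + + 2 * z - + 2 * t ≡ + 0 [mod + 5 ])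
    ⊎ (x + + 2 * y - z - + 2 * t ≡ + 0 [mod + 5 ])
    ⊎ (x - + 2 * y - z + + 2 * t ≡ + 0 [mod + 5 ]) ) →
    ∃[ x' ] ∃[ y' ] ∃[ z' ] ∃[ t' ]
      ( m ≡ x' * x' + y' * y' + z' * z' + t' * t'
      × n ≡ ((a + + 4 * b) / + 5) * x' + ((+ 7 * a - + 2 * b) / + 5) * y'
            + ((+ 3 * a + + 2 * b) / + 5) * z' + ((+ 4 * a + b) / + 5) * t' )
lemma3p7 a b _ a≡b _ m n x y z t refl refl cases
  with k , refl ← ≡-mod⇒≡+multiple {a} {b} {+ 5} a≡b
  with c₁ , c₂ , c₃ , c₄ ← /5-coefficients b k
  rewrite c₁ | c₂ | c₃ | c₄ = Represented-any-case b k t x y z cases
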